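{- If $G$ is a cycle $C_n$, an empty graph $\overline{K}_n$, a star $S_n$, a wheel $W_n$, or a complete graph $K_n$, then $\overline{\operatorname{Z}}(G)=\operatorname{Z}(G)$.
   Context: All graphs are finite, simple and undirected. $\overline{K}_n$ is the graph on $n$ vertices with no edges; the star is $S_n=\overline{K}_{n-1}\vee K_1$ and the wheel is $W_n=C_{n-1}\vee K_1$, where $\vee$ denotes the join (disjoint union plus all edges between the two graphs). Given a set $S$ of initially blue vertices (all others white), the zero forcing color change rule says that a blue vertex with exactly one white neighbor causes that neighbor to become blue. $S$ is a zero forcing set if repeatedly applying this rule eventually makes every vertex blue. $\operatorname{Z}(G)$ is the minimum cardinality of a zero forcing set of $G$. A minimal zero forcing set is a zero forcing set containing no other zero forcing set as a proper subset, and $\overline{\operatorname{Z}}(G)$ is the maximum size of a minimal zero forcing set of $G$. -}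

module Defs where

open import Data.Nat using (ℕ; zero; suc; _+_; _≤_)
open import Data.Nat.Properties using () renaming (_≟_ to _≟ℕ_)
open import Data.Fin using (Fin; toℕ; splitAt; _≟_)
open import Data.Fin.Subset using (Subset; _∈_; _∉_; _∪_; ⁅_⁆; ⊤; ∣_∣; _⊂_)
open import Data.Bool using (Bool; true; false; _∧_; _∨_; not)
open import Data.Sum using (_⊎_; inj₁; inj₂)
open import Data.Product using (Σ; _×_; _,_)
open import Relation.Nullary using (¬_)
open import Relation.Nullary.Decidable using (⌊_⌋)
open import Relation.Binary.PropositionalEquality using (_≡_; _≢_)

-- A finite simple graph on vertex set Fin n, given by a Boolean adjacency
-- function. All concrete graphs below are symmetric and loopless by construction.
record Graph (n : ℕ) : Set where
  field
    adj : Fin n → Fin n → Bool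
open Graph public

Adj : ∀ {n} → Graph n → Fin n → Fin n → Set
Adj G u w = adj G u w ≡ true

emptyG : (n : ℕ) → Graph n
emptyG n = record { adj = λ _ _ → false }

completeG : (n : ℕ) → Graph n
completeG n = record { adj = λ u w → not ⌊ u ≟ w ⌋ }

-- Cycle C_n (meaningful for n ≥ 3): vertices 0,…,n-1, i ~ i+1 and 0 ~ n-1
cycleG : (n : ℕ) → Graph n
cycleG n = record { adj = λ u w → step u w ∨ step w u }
  where
  step : Fin n → Fin n → Bool
  step u w = ⌊ suc (toℕ u) ≟ℕ toℕ w ⌋
           ∨ (⌊ toℕ w ≟ℕ 0 ⌋ ∧ ⌊ suc (toℕ u) ≟ℕ n ⌋)

join : ∀ {m n} → Graph m → Graph n → Graph (m + n)
join {m} {n} G H = record { adj = λ u w → j (splitAt m u) (splitAt m w) }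
  where
  j : Fin m ⊎ Fin n → Fin m ⊎ Fin n → Bool
  j (inj₁ a) (inj₁ b) = adj G a b
  j (inj₂ a) (inj₂ b) = adj H a b
  j (inj₁ _) (inj₂ _) = true
  j (inj₂ _) (inj₁ _) = true

-- Star S_n = K̄_{n-1} ∨ K_1   (n ≥ 1)
starG : (n : ℕ) → Graph (n + 1)
starG n = join (emptyG n) (completeG 1)

-- Wheel W_n = C_{n-1} ∨ K_1  (n ≥ 4)
wheelG : (n : ℕ) → Graph (n + 1)
wheelG n = join (cycleG n) (completeG 1)

-- One application of the color change rule: blue vertex u whose only white
-- neighbour is w forces w.
data ForceStep {n} (G : Graph n) (S : Subset n) : Subset n → Set where
  force : (u w : Fin n) → u ∈ S → w ∉ S → Adj G u w →
          (∀ x → Adj G u x → x ≢ w → x ∈ S) →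
          ForceStep G S (S ∪ ⁅ w ⁆)

data Forces {n} (G : Graph n) : Subset n → Subset n → Set where
  done : ∀ {S} → Forces G S S
  step : ∀ {S T U} → ForceStep G S T → Forces G T U → Forces G S U

IsZeroForcingSet : ∀ {n} → Graph n → Subset n → Set
IsZeroForcingSet G S = Forces G S ⊤

IsMinimalZeroForcingSet : ∀ {n} → Graph n → Subset n → Set
IsMinimalZeroForcingSet G S =
  IsZeroForcingSet G S × (∀ T → T ⊂ S → ¬ IsZeroForcingSet G T)

IsZ : ∀ {n} → Graph n → ℕ → Set
IsZ G k = Σ _ (λ S → IsZeroForcingSet G S × ∣ S ∣ ≡ k)
        × (∀ S → IsZeroForcingSet G S → k ≤ ∣ S ∣)

IsZbar : ∀ {n} → Graph n → ℕ → Set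
IsZbar G k = Σ _ (λ S → IsMinimalZeroForcingSet G S × ∣ S ∣ ≡ k)
           × (∀ S → IsMinimalZeroForcingSet G S → ∣ S ∣ ≤ k)

-- Z̄(G) = Z(G)   (both values always exist, since the graphs are finite)
ZbarEqZ : ∀ {n} → Graph n → Set
ZbarEqZ G = ∀ a b → IsZ G a → IsZbar G b → b ≡ a

-- For each of these graphs there is a number c such that every zero forcing
-- set contains a zero forcing set of size c.  Then Z(G) = c, and a minimal
-- zero forcing set has to coincide with the one inside it, so Z̄(G) = c too.
-- The small set is read off the first force u → w of a zero forcing set: in
-- K_n every vertex but w is blue; in C_n, u and its other neighbour are two
-- adjacent blue vertices, and such a pair forces its way around the cycle; in
-- W_n the hub, or the rim neighbours of u, complete such a pair to a set of
-- three; in S_n two white leaves are twins and are never forced, so all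
-- leaves but one are blue.  In an edgeless graph nothing is ever forced.

module Submission where

open import Defs
open import Data.Bool using (true; _∨_; _∧_)
open import Data.Nat
  using (ℕ; zero; suc; pred; _+_; _∸_; _≤_; _<_; z≤n; s≤s; NonZero; >-nonZero; _%_)
import Data.Nat.Properties as ℕ
open import Data.Nat.Properties
  using (≤-antisym; ≤-trans; suc-injective; 1+n≢n; <-irrefl; m≤n⇒m<n∨m≡n; +-suc; +-assoc;
         +-comm; +-identityʳ; m+[n∸m]≡n; suc-pred; <⇒≤; m<n⇒m<1+n; n<1+n)
open import Data.Nat.DivMod
  using (m%n<n; m<n⇒m%n≡m; n%n≡0; m%n%n≡m%n; %-distribˡ-+; [m+n]%n≡m%n)
open import Data.Product using (_×_; _,_; proj₁; ∃)
open import Data.Sum using (_⊎_; inj₁; inj₂)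
import Data.Sum
open import Data.Vec using (_∷_; here; there)
open import Data.Fin
  using (Fin; zero; suc; toℕ; fromℕ<; _≟_; punchIn; splitAt; _↑ˡ_; _↑ʳ_)
open import Data.Fin.Properties
  using (toℕ-fromℕ<; toℕ<n; toℕ-injective; punchInᵢ≢i; all?; ¬∀⟶∃¬;
         ↑ˡ-injective; splitAt-↑ˡ; splitAt-↑ʳ; splitAt⁻¹-↑ˡ; splitAt⁻¹-↑ʳ)
open import Data.Fin.Subset
  using (Subset; _∈_; _∉_; _∪_; ⁅_⁆; ⊤; ∁; ∣_∣; _⊆_; _⊂_; _⊃_; inside; outside)
open import Data.Fin.Subset.Properties
  using (_∈?_; nonempty?; ⊆-refl; ⊆-trans; ⊆-antisym; ⊆⊤; ∈⊤; ∣⊤∣≡n; p⊆q⇒∣p∣≤∣q∣;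
         p⊆p∪q; x∈p∪q⁺; x∈p∪q⁻; x∈⁅x⁆; x∈⁅y⁆⇒x≡y; ∣⁅x⁆∣≡1; ∪-identityʳ;
         x∈∁p⇒x∉p; x∉∁p⇒x∈p; x∉p⇒x∈∁p; x≢y⇒x∉⁅y⁆; x∉⁅y⁆⇒x≢y; ∣∁p∣≡n∸∣p∣)
open import Data.Fin.Subset.Induction using (Acc; acc; ⊃-wellFounded)
open import Function using (_∘_; id)
open import Relation.Nullary using (¬_; Dec; yes; no; contradiction; does)
open import Relation.Nullary.Decidable using (_⊎-dec_; _×-dec_; dec-true; ⌊_⌋; isYes≗does)
open import Relation.Unary using (Decidable)
open import Relation.Binary.PropositionalEquality
  using (_≡_; _≢_; refl; sym; trans; cong; cong₂; subst; module ≡-Reasoning)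

∣p∪⁅x⁆∣≡1+∣p∣ : ∀ {n} (p : Subset n) {x} → x ∉ p → ∣ p ∪ ⁅ x ⁆ ∣ ≡ suc ∣ p ∣
∣p∪⁅x⁆∣≡1+∣p∣ (inside  ∷ p) {zero}  x∉p = contradiction here x∉p
∣p∪⁅x⁆∣≡1+∣p∣ (outside ∷ p) {zero}  x∉p = cong (suc ∘ ∣_∣) (∪-identityʳ p)
∣p∪⁅x⁆∣≡1+∣p∣ (inside  ∷ p) {suc x} x∉p = cong suc (∣p∪⁅x⁆∣≡1+∣p∣ p (x∉p ∘ there))
∣p∪⁅x⁆∣≡1+∣p∣ (outside ∷ p) {suc x} x∉p = ∣p∪⁅x⁆∣≡1+∣p∣ p (x∉p ∘ there)

∈∁⁅⁆ : ∀ {n} {x w : Fin n} → x ≢ w → x ∈ ∁ ⁅ w ⁆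
∈∁⁅⁆ x≢w = x∉p⇒x∈∁p (x≢y⇒x∉⁅y⁆ x≢w)

∈∁⁅⁆⁻ : ∀ {n} {x w : Fin n} → x ∈ ∁ ⁅ w ⁆ → x ≢ w
∈∁⁅⁆⁻ = x∉⁅y⁆⇒x≢y ∘ x∈∁p⇒x∉p

pair : ∀ {n} → Fin n → Fin n → Subset n
pair a b = ⁅ a ⁆ ∪ ⁅ b ⁆

triple : ∀ {n} → Fin n → Fin n → Fin n → Subset n
triple a b c = pair a b ∪ ⁅ c ⁆

module _ {n : ℕ} {a b : Fin n} where

  ∈pair₁ : a ∈ pair a b
  ∈pair₁ = x∈p∪q⁺ (inj₁ (x∈⁅x⁆ a))

  ∈pair₂ : b ∈ pair a b
  ∈pair₂ = x∈p∪q⁺ (inj₂ (x∈⁅x⁆ b))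

  ∈pair⁻ : ∀ {x} → x ∈ pair a b → x ≡ a ⊎ x ≡ b
  ∈pair⁻ = Data.Sum.map (x∈⁅y⁆⇒x≡y a) (x∈⁅y⁆⇒x≡y b) ∘ x∈p∪q⁻ ⁅ a ⁆ ⁅ b ⁆

  pair⊆ : ∀ {S} → a ∈ S → b ∈ S → pair a b ⊆ S
  pair⊆ a∈S b∈S x∈ab with ∈pair⁻ x∈ab
  ... | inj₁ refl = a∈S
  ... | inj₂ refl = b∈S

  ∣pair∣ : a ≢ b → ∣ pair a b ∣ ≡ 2
  ∣pair∣ a≢b = trans (∣p∪⁅x⁆∣≡1+∣p∣ ⁅ a ⁆ (a≢b ∘ sym ∘ x∈⁅y⁆⇒x≡y a)) (cong suc (∣⁅x⁆∣≡1 a))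

module _ {n : ℕ} {a b c : Fin n} where

  ∈triple₁ : a ∈ triple a b c
  ∈triple₁ = x∈p∪q⁺ (inj₁ ∈pair₁)

  ∈triple₂ : b ∈ triple a b c
  ∈triple₂ = x∈p∪q⁺ (inj₁ ∈pair₂)

  ∈triple₃ : c ∈ triple a b c
  ∈triple₃ = x∈p∪q⁺ (inj₂ (x∈⁅x⁆ c))

  triple⊆ : ∀ {S} → a ∈ S → b ∈ S → c ∈ S → triple a b c ⊆ S
  triple⊆ a∈S b∈S c∈S x∈abc with x∈p∪q⁻ (pair a b) ⁅ c ⁆ x∈abc
  ... | inj₁ x∈ab = pair⊆ a∈S b∈S x∈ab
  ... | inj₂ x∈c with refl ← x∈⁅y⁆⇒x≡y c x∈c = c∈S

  ∣triple∣ : a ≢ b → a ≢ c → b ≢ c → ∣ triple a b c ∣ ≡ 3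
  ∣triple∣ a≢b a≢c b≢c = trans (∣p∪⁅x⁆∣≡1+∣p∣ (pair a b) c∉ab) (cong suc (∣pair∣ a≢b))
    where
    c∉ab : c ∉ pair a b
    c∉ab c∈ab with ∈pair⁻ c∈ab
    ... | inj₁ c≡a = a≢c (sym c≡a)
    ... | inj₂ c≡b = b≢c (sym c≡b)

smallest-counterexample : ∀ {Q : ℕ → Set} → Decidable Q → ∀ c → ¬ Q c →
                          ∃ λ m → ¬ Q m × (∀ j → j < m → Q j)
smallest-counterexample Q? zero ¬Q0 = 0 , ¬Q0 , λ _ ()
smallest-counterexample Q? (suc c) ¬Qc with Q? 0
... | no ¬Q0 = 0 , ¬Q0 , λ _ ()
... | yes Q0 with m , ¬Qm , below ← smallest-counterexample (Q? ∘ suc) c ¬Qc =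
  suc m , ¬Qm , λ { zero _ → Q0 ; (suc j) (s≤s j<m) → below j j<m }

module ZeroForcing {n : ℕ} (G : Graph n) where

  initial-step : ∀ {S} → IsZeroForcingSet G S → S ≡ ⊤ ⊎ ∃ (ForceStep G S)
  initial-step done       = inj₁ refl
  initial-step (step s _) = inj₂ (_ , s)

  AlwaysForces : Subset n → Set
  AlwaysForces T = ∀ S → T ⊆ S → ∃ (_∉ S) → ∃ (ForceStep G S)

  alwaysForces⇒zeroForcing : ∀ {T} → AlwaysForces T → IsZeroForcingSet G T
  alwaysForces⇒zeroForcing {T} forces = go T (⊃-wellFounded T) ⊆-refl
    where
    go : ∀ S → Acc _⊃_ S → T ⊆ S → Forces G S ⊤
    go S (acc smaller) T⊆S with nonempty? (∁ S)
    ... | no noWhite = subst (Forces G S) S≡⊤ done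
      where
      S≡⊤ : S ≡ ⊤
      S≡⊤ = ⊆-antisym ⊆⊤ (λ _ → x∉∁p⇒x∈p (λ x∈∁S → noWhite (_ , x∈∁S)))
    ... | yes (x , x∈∁S) with forces S T⊆S (x , x∈∁p⇒x∉p x∈∁S)
    ...   | _ , s@(force _ w _ w∉S _ _) =
      step s (go _ (smaller S⊂S∪⁅w⁆) (⊆-trans T⊆S (p⊆p∪q ⁅ w ⁆)))
      where
      S⊂S∪⁅w⁆ : S ⊂ S ∪ ⁅ w ⁆
      S⊂S∪⁅w⁆ = p⊆p∪q ⁅ w ⁆ , w , x∈p∪q⁺ (inj₂ (x∈⁅x⁆ w)) , w∉S

  minimal⇒⊆ : ∀ {S T} → IsMinimalZeroForcingSet G S →
              T ⊆ S → IsZeroForcingSet G T → S ⊆ T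
  minimal⇒⊆ {S} {T} (_ , noSmaller) T⊆S zfsT {x} x∈S with x ∈? T
  ... | yes x∈T = x∈T
  ... | no  x∉T = contradiction zfsT (noSmaller T (T⊆S , x , x∈S , x∉T))

  ContainsZFSOfSize : ℕ → Subset n → Set
  ContainsZFSOfSize c S = ∃ λ T → T ⊆ S × IsZeroForcingSet G T × ∣ T ∣ ≡ c

  containsZFSOfSize⇒ZbarEqZ : (c : ℕ) →
    (∀ S → IsZeroForcingSet G S → ContainsZFSOfSize c S) → ZbarEqZ G
  containsZFSOfSize⇒ZbarEqZ c core a b
    ((A , zfsA , refl) , minimum) ((B , minB@(zfsB , _) , refl) , _) =
    ≤-antisym (≤-trans ∣B∣≤c c≤∣A∣) (minimum B zfsB)
    where
    c≤∣A∣ : c ≤ ∣ A ∣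
    c≤∣A∣ with core A zfsA
    ... | T , T⊆A , _ , refl = p⊆q⇒∣p∣≤∣q∣ T⊆A
    ∣B∣≤c : ∣ B ∣ ≤ c
    ∣B∣≤c with core B zfsB
    ... | T , T⊆B , zfsT , refl = p⊆q⇒∣p∣≤∣q∣ (minimal⇒⊆ minB T⊆B zfsT)

  Edgeless : Set
  Edgeless = ∀ u w → ¬ Adj G u w

  edgeless⇒ZbarEqZ : Edgeless → ZbarEqZ G
  edgeless⇒ZbarEqZ noEdge =
    containsZFSOfSize⇒ZbarEqZ n (λ S zfs → S , ⊆-refl , zfs , ∣S∣≡n zfs)
    where
    ∣S∣≡n : ∀ {S} → IsZeroForcingSet G S → ∣ S ∣ ≡ n
    ∣S∣≡n zfs with initial-step zfs
    ... | inj₁ refl                      = ∣⊤∣≡n n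
    ... | inj₂ (_ , force u w _ _ u~w _) = contradiction u~w (noEdge u w)

  stays-white : ∀ {u v S T} → (∀ t → Adj G t u → Adj G t v) → u ≢ v →
                u ∉ S → v ∉ S → ForceStep G S T → u ∉ T
  stays-white {u} {v} N[u]⊆N[v] u≢v u∉S v∉S (force t w _ _ t~w others) u∈T
    with x∈p∪q⁻ _ ⁅ w ⁆ u∈T
  ... | inj₁ u∈S = u∉S u∈S
  ... | inj₂ u∈⁅w⁆ with refl ← x∈⁅y⁆⇒x≡y w u∈⁅w⁆ =
    v∉S (others v (N[u]⊆N[v] t t~w) (u≢v ∘ sym))

  Twins : Fin n → Fin n → Set
  Twins u v = (∀ t → Adj G t u → Adj G t v) × (∀ t → Adj G t v → Adj G t u)

  twins-stay-white : ∀ {u v S T} → Twins u v → u ≢ v →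
                     u ∉ S → v ∉ S → Forces G S T → u ∉ T × v ∉ T
  twins-stay-white _ _ u∉S v∉S done = u∉S , v∉S
  twins-stay-white tw@(uv , vu) u≢v u∉S v∉S (step s f) =
    twins-stay-white tw u≢v (stays-white uv u≢v u∉S v∉S s)
                            (stays-white vu (u≢v ∘ sym) v∉S u∉S s) f

  zeroForcing-meets-twins : ∀ {u v S} → Twins u v → u ≢ v →
                            IsZeroForcingSet G S → u ∈ S ⊎ v ∈ S
  zeroForcing-meets-twins {u} {v} {S} tw u≢v zfs with u ∈? S | v ∈? S
  ... | yes u∈S | _       = inj₁ u∈S
  ... | no  _   | yes v∈S = inj₂ v∈S
  ... | no  u∉S | no  v∉S = contradiction ∈⊤ (proj₁ (twins-stay-white tw u≢v u∉S v∉S zfs))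

Complete : ∀ {n} → Graph n → Set
Complete G = ∀ {u w} → u ≢ w → Adj G u w

complete⇒ZbarEqZ : ∀ {k} (G : Graph (suc (suc k))) → Complete G → ZbarEqZ G
complete⇒ZbarEqZ {k} G adjacent = containsZFSOfSize⇒ZbarEqZ (suc k) core
  where
  open ZeroForcing G

  ∣∁⁅w⁆∣ : ∀ w → ∣ ∁ ⁅ w ⁆ ∣ ≡ suc k
  ∣∁⁅w⁆∣ w = trans (∣∁p∣≡n∸∣p∣ ⁅ w ⁆) (cong (suc (suc k) ∸_) (∣⁅x⁆∣≡1 w))

  ∁⁅w⁆-forces : ∀ w → AlwaysForces (∁ ⁅ w ⁆)
  ∁⁅w⁆-forces w S ∁⁅w⁆⊆S (x , x∉S) with x ≟ w
  ... | no  x≢w = contradiction (∁⁅w⁆⊆S (∈∁⁅⁆ x≢w)) x∉S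
  ... | yes refl =
    _ , force u x (∁⁅w⁆⊆S (∈∁⁅⁆ u≢x)) x∉S (adjacent u≢x) (λ t _ t≢x → ∁⁅w⁆⊆S (∈∁⁅⁆ t≢x))
    where
    u = punchIn x zero
    u≢x = punchInᵢ≢i x zero

  core : ∀ S → IsZeroForcingSet G S → ContainsZFSOfSize (suc k) S
  core S zfs with initial-step zfs
  ... | inj₁ refl = ∁ ⁅ zero ⁆ , ⊆⊤ , alwaysForces⇒zeroForcing (∁⁅w⁆-forces zero) , ∣∁⁅w⁆∣ zero
  ... | inj₂ (_ , force u w u∈S _ _ others) =
    ∁ ⁅ w ⁆ , ∁⁅w⁆⊆S , alwaysForces⇒zeroForcing (∁⁅w⁆-forces w) , ∣∁⁅w⁆∣ w
    where
    ∁⁅w⁆⊆S : ∁ ⁅ w ⁆ ⊆ S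
    ∁⁅w⁆⊆S {x} x∈∁⁅w⁆ with u ≟ x
    ... | yes refl = u∈S
    ... | no  u≢x  = others x (adjacent u≢x) (∈∁⁅⁆⁻ x∈∁⁅w⁆)

does≡true⇒ : ∀ {A : Set} (a? : Dec A) → does a? ≡ true → A
does≡true⇒ (yes a) _ = a

CycleStep : ℕ → ℕ → ℕ → Set
CycleStep n i j = suc i ≡ j ⊎ (j ≡ 0 × suc i ≡ n)

cycleStep? : ∀ n i j → Dec (CycleStep n i j)
cycleStep? n i j = suc i ℕ.≟ j ⊎-dec (j ℕ.≟ 0 ×-dec suc i ℕ.≟ n)

cycleStep-injective : ∀ {n i i′ j} → CycleStep n i j → CycleStep n i′ j → i ≡ i′
cycleStep-injective (inj₁ refl)       (inj₁ e)          = suc-injective (sym e)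
cycleStep-injective (inj₁ refl)       (inj₂ (() , _))
cycleStep-injective (inj₂ (refl , _)) (inj₁ ())
cycleStep-injective (inj₂ (_ , e))    (inj₂ (_ , e′))   = suc-injective (trans e (sym e′))

cycleStep-irreflexive : ∀ {n i} → 1 < n → ¬ CycleStep n i i
cycleStep-irreflexive _   (inj₁ e)           = 1+n≢n e
cycleStep-irreflexive 1<n (inj₂ (refl , refl)) = <-irrefl refl 1<n

cycleStep-asymmetric : ∀ {n i j} → 2 < n → CycleStep n i j → ¬ CycleStep n j i
cycleStep-asymmetric _ (inj₁ refl) (inj₁ e) = <-irrefl (sym e) (m<n⇒m<1+n (n<1+n _))
cycleStep-asymmetric 2<n (inj₁ refl) (inj₂ (refl , refl)) = <-irrefl refl 2<n
cycleStep-asymmetric 2<n (inj₂ (refl , refl)) (inj₁ refl) = <-irrefl refl 2<n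
cycleStep-asymmetric (s≤s ()) (inj₂ (refl , _)) (inj₂ (refl , refl))

suc[m%n]%n≡suc[m]%n : ∀ m n .{{_ : NonZero n}} → suc (m % n) % n ≡ suc m % n
suc[m%n]%n≡suc[m]%n m n = begin
  (1 + m % n) % n           ≡⟨ %-distribˡ-+ 1 (m % n) n ⟩
  (1 % n + m % n % n) % n   ≡⟨ cong (λ k → (1 % n + k) % n) (m%n%n≡m%n m n) ⟩
  (1 % n + m % n) % n       ≡⟨ %-distribˡ-+ 1 m n ⟨
  (1 + m) % n               ∎
  where open ≡-Reasoning

module CyclicSuccessor (n : ℕ) {{_ : NonZero n}} where

  next : Fin n → Fin n
  next u = fromℕ< (m%n<n (suc (toℕ u)) n)

  rot : Fin n → ℕ → Fin n
  rot u j = fromℕ< (m%n<n (toℕ u + j) n)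

  toℕ-next : ∀ u → toℕ (next u) ≡ suc (toℕ u) % n
  toℕ-next u = toℕ-fromℕ< _

  toℕ-rot : ∀ u j → toℕ (rot u j) ≡ (toℕ u + j) % n
  toℕ-rot u j = toℕ-fromℕ< _

  cycleStep-next : ∀ u → CycleStep n (toℕ u) (toℕ (next u))
  cycleStep-next u with m≤n⇒m<n∨m≡n (toℕ<n u)
  ... | inj₁ 1+u<n = inj₁ (sym (trans (toℕ-next u) (m<n⇒m%n≡m 1+u<n)))
  ... | inj₂ 1+u≡n = inj₂ (trans (toℕ-next u) (trans (cong (_% n) 1+u≡n) (n%n≡0 n)) , 1+u≡n)

  cycleStep⇒≡next : ∀ {u w} → CycleStep n (toℕ u) (toℕ w) → w ≡ next u
  cycleStep⇒≡next {u} {w} (inj₁ 1+u≡w) = toℕ-injective (begin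
    toℕ w              ≡⟨ m<n⇒m%n≡m (toℕ<n w) ⟨
    toℕ w % n          ≡⟨ cong (_% n) 1+u≡w ⟨
    suc (toℕ u) % n    ≡⟨ toℕ-next u ⟨
    toℕ (next u)       ∎)
    where open ≡-Reasoning
  cycleStep⇒≡next {u} {w} (inj₂ (w≡0 , 1+u≡n)) = toℕ-injective (begin
    toℕ w              ≡⟨ w≡0 ⟩
    0                  ≡⟨ n%n≡0 n ⟨
    n % n              ≡⟨ cong (_% n) 1+u≡n ⟨
    suc (toℕ u) % n    ≡⟨ toℕ-next u ⟨
    toℕ (next u)       ∎)
    where open ≡-Reasoning

  next-injective : ∀ {u v} → next u ≡ next v → u ≡ v
  next-injective {u} {v} eq = toℕ-injective (cycleStep-injective (cycleStep-next u)
    (subst (CycleStep n (toℕ v) ∘ toℕ) (sym eq) (cycleStep-next v)))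

  next≢ : 1 < n → ∀ u → next u ≢ u
  next≢ 1<n u eq =
    cycleStep-irreflexive 1<n (subst (CycleStep n (toℕ u) ∘ toℕ) eq (cycleStep-next u))

  next²≢ : 2 < n → ∀ u → next (next u) ≢ u
  next²≢ 2<n u eq = cycleStep-asymmetric 2<n (cycleStep-next u)
    (subst (CycleStep n (toℕ (next u)) ∘ toℕ) eq (cycleStep-next (next u)))

  rot-zero : ∀ u → rot u 0 ≡ u
  rot-zero u = toℕ-injective (begin
    toℕ (rot u 0)    ≡⟨ toℕ-rot u 0 ⟩
    (toℕ u + 0) % n  ≡⟨ cong (_% n) (+-identityʳ (toℕ u)) ⟩
    toℕ u % n        ≡⟨ m<n⇒m%n≡m (toℕ<n u) ⟩
    toℕ u            ∎)
    where open ≡-Reasoning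

  rot-suc : ∀ u j → rot u (suc j) ≡ next (rot u j)
  rot-suc u j = toℕ-injective (begin
    toℕ (rot u (suc j))        ≡⟨ toℕ-rot u (suc j) ⟩
    (toℕ u + suc j) % n        ≡⟨ cong (_% n) (+-suc (toℕ u) j) ⟩
    suc (toℕ u + j) % n        ≡⟨ suc[m%n]%n≡suc[m]%n (toℕ u + j) n ⟨
    suc ((toℕ u + j) % n) % n  ≡⟨ cong (λ k → suc k % n) (toℕ-rot u j) ⟨
    suc (toℕ (rot u j)) % n    ≡⟨ toℕ-next (rot u j) ⟨
    toℕ (next (rot u j))       ∎)
    where open ≡-Reasoning

  rot-reaches : ∀ u z → rot u (toℕ z + (n ∸ toℕ u)) ≡ z
  rot-reaches u z = toℕ-injective (begin
    toℕ (rot u (toℕ z + (n ∸ toℕ u)))   ≡⟨ toℕ-rot u _ ⟩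
    (toℕ u + (toℕ z + (n ∸ toℕ u))) % n ≡⟨ cong (_% n) u+[z+[n∸u]]≡z+n ⟩
    (toℕ z + n) % n                     ≡⟨ [m+n]%n≡m%n (toℕ z) n ⟩
    toℕ z % n                           ≡⟨ m<n⇒m%n≡m (toℕ<n z) ⟩
    toℕ z                               ∎)
    where
    open ≡-Reasoning
    u+[z+[n∸u]]≡z+n : toℕ u + (toℕ z + (n ∸ toℕ u)) ≡ toℕ z + n
    u+[z+[n∸u]]≡z+n = begin
      toℕ u + (toℕ z + (n ∸ toℕ u)) ≡⟨ cong (toℕ u +_) (+-comm (toℕ z) _) ⟩
      toℕ u + ((n ∸ toℕ u) + toℕ z) ≡⟨ +-assoc (toℕ u) _ (toℕ z) ⟨
      (toℕ u + (n ∸ toℕ u)) + toℕ z ≡⟨ cong (_+ toℕ z) (m+[n∸m]≡n (<⇒≤ (toℕ<n u))) ⟩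
      n + toℕ z                     ≡⟨ +-comm n (toℕ z) ⟩
      toℕ z + n                     ∎

  prev : Fin n → Fin n
  prev u = rot u (pred n)

  next-prev : ∀ u → next (prev u) ≡ u
  next-prev u = begin
    next (rot u (pred n))  ≡⟨ rot-suc u (pred n) ⟨
    rot u (suc (pred n))   ≡⟨ cong (rot u) (suc-pred n) ⟩
    rot u n                ≡⟨ cong (rot u) (m+[n∸m]≡n (<⇒≤ (toℕ<n u))) ⟨
    rot u (toℕ u + (n ∸ toℕ u)) ≡⟨ rot-reaches u u ⟩
    u                      ∎
    where open ≡-Reasoning

  cycleAdjacency? : (u w : Fin n) →
                    Dec (CycleStep n (toℕ u) (toℕ w) ⊎ CycleStep n (toℕ w) (toℕ u))
  cycleAdjacency? u w = cycleStep? n (toℕ u) (toℕ w) ⊎-dec cycleStep? n (toℕ w) (toℕ u)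

  -- cycleG decides adjacency with ⌊_⌋ = isYes, which agrees with does only
  -- propositionally.
  adj≡cycleAdjacency? : (u w : Fin n) → adj (cycleG n) u w ≡ does (cycleAdjacency? u w)
  adj≡cycleAdjacency? u w =
    cong₂ _∨_ (isYes≡cycleStep? (toℕ u) (toℕ w)) (isYes≡cycleStep? (toℕ w) (toℕ u))
    where
    isYes≡cycleStep? : ∀ i j →
      ⌊ suc i ℕ.≟ j ⌋ ∨ (⌊ j ℕ.≟ 0 ⌋ ∧ ⌊ suc i ℕ.≟ n ⌋) ≡ does (cycleStep? n i j)
    isYes≡cycleStep? i j
      rewrite isYes≗does (suc i ℕ.≟ j) | isYes≗does (j ℕ.≟ 0) | isYes≗does (suc i ℕ.≟ n) = refl

  adj⇒next : ∀ {u w} → Adj (cycleG n) u w → w ≡ next u ⊎ u ≡ next w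
  adj⇒next {u} {w} u~w = Data.Sum.map cycleStep⇒≡next cycleStep⇒≡next
    (does≡true⇒ (cycleAdjacency? u w) (trans (sym (adj≡cycleAdjacency? u w)) u~w))

  adj-next : ∀ u → Adj (cycleG n) u (next u)
  adj-next u = trans (adj≡cycleAdjacency? u (next u))
    (dec-true (cycleAdjacency? u (next u)) (inj₁ (cycleStep-next u)))

  next-adj : ∀ u → Adj (cycleG n) (next u) u
  next-adj u = trans (adj≡cycleAdjacency? (next u) u)
    (dec-true (cycleAdjacency? (next u) u) (inj₂ (cycleStep-next u)))

  prev-next : ∀ u → prev (next u) ≡ u
  prev-next u = next-injective (next-prev (next u))

  adj-prev : ∀ u → Adj (cycleG n) u (prev u)
  adj-prev u = subst (λ v → Adj (cycleG n) v (prev u)) (next-prev u) (next-adj (prev u))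

  neighbours : ∀ {u t} → Adj (cycleG n) u t → t ≡ next u ⊎ t ≡ prev u
  neighbours {u} u~t with adj⇒next u~t
  ... | inj₁ t≡next = inj₁ t≡next
  ... | inj₂ refl   = inj₂ (sym (prev-next _))

  prev≢ : 1 < n → ∀ u → prev u ≢ u
  prev≢ 1<n u eq = next≢ 1<n (prev u) (trans (next-prev u) (sym eq))

  prev≢next : 2 < n → ∀ u → prev u ≢ next u
  prev≢next 2<n u eq = next²≢ 2<n (prev u) (trans (cong next (next-prev u)) (sym eq))

  -- Walking around the cycle from a, the first vertex outside P is forced by
  -- its predecessor.
  first-exit : ∀ {P : Fin n → Set} → Decidable P → ∀ {a z} → P a → P (next a) → ¬ P z →
               ∃ λ y → P (prev y) × P y × ¬ P (next y)
  first-exit {P} P? {a} {z} Pa Pna ¬Pz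
    with smallest-counterexample (P? ∘ rot a) _ (¬Pz ∘ subst P (rot-reaches a z))
  ... | zero , ¬P[a] , _ = contradiction (subst P (sym (rot-zero a)) Pa) ¬P[a]
  ... | suc zero , ¬P[na] , _ =
    contradiction (subst P (sym (trans (rot-suc a 0) (cong next (rot-zero a)))) Pna) ¬P[na]
  ... | suc (suc m) , ¬P[m+2] , below =
    rot a (suc m) , subst P prev-step (below m (m<n⇒m<1+n (n<1+n m)))
                  , below (suc m) (n<1+n (suc m))
                  , ¬P[m+2] ∘ subst P (sym (rot-suc a (suc m)))
    where
    prev-step : rot a m ≡ prev (rot a (suc m))
    prev-step = trans (sym (prev-next (rot a m))) (cong prev (sym (rot-suc a m)))

  adjacent-pair-beside : 2 < n → ∀ {P : Fin n → Set} {u w} → Adj (cycleG n) u w → P u →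
                         (∀ t → Adj (cycleG n) u t → t ≢ w → P t) → ∃ λ a → P a × P (next a)
  adjacent-pair-beside 2<n {P} {u} {w} u~w Pu others with neighbours {u} {w} u~w
  ... | inj₁ refl = prev u , others (prev u) (adj-prev u) (prev≢next 2<n u)
                           , subst P (sym (next-prev u)) Pu
  ... | inj₂ refl = u , Pu , others (next u) (adj-next u) (prev≢next 2<n u ∘ sym)

module JoinWithVertex {m : ℕ} (G : Graph m) where

  rim : Fin m → Fin (m + 1)
  rim r = r ↑ˡ 1

  hub : Fin (m + 1)
  hub = m ↑ʳ zero

  data View : Fin (m + 1) → Set where
    at-rim : ∀ r → View (rim r)
    at-hub : View hub

  view : ∀ v → View v
  view v with splitAt m v in eq
  ... | inj₁ r    = subst View (splitAt⁻¹-↑ˡ eq) (at-rim r)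
  ... | inj₂ zero = subst View (splitAt⁻¹-↑ʳ eq) at-hub

  rim-injective : ∀ {r s} → rim r ≡ rim s → r ≡ s
  rim-injective = ↑ˡ-injective 1 _ _

  rim≢hub : ∀ r → rim r ≢ hub
  rim≢hub r eq
    with () ← trans (sym (splitAt-↑ˡ m r 1)) (trans (cong (splitAt m) eq) (splitAt-↑ʳ m 1 zero))

  adj-rim : ∀ r s → adj (join G (completeG 1)) (rim r) (rim s) ≡ adj G r s
  adj-rim r s rewrite splitAt-↑ˡ m r 1 | splitAt-↑ˡ m s 1 = refl

  rim-adj : ∀ {r s} → Adj G r s → Adj (join G (completeG 1)) (rim r) (rim s)
  rim-adj {r} {s} = trans (adj-rim r s)

  rim-adj⁻ : ∀ {r s} → Adj (join G (completeG 1)) (rim r) (rim s) → Adj G r s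
  rim-adj⁻ {r} {s} = trans (sym (adj-rim r s))

  rim-hub : ∀ r → Adj (join G (completeG 1)) (rim r) hub
  rim-hub r rewrite splitAt-↑ˡ m r 1 | splitAt-↑ʳ m 1 zero = refl

  hub-rim : ∀ r → Adj (join G (completeG 1)) hub (rim r)
  hub-rim r rewrite splitAt-↑ˡ m r 1 | splitAt-↑ʳ m 1 zero = refl

  hub-loopless : ¬ Adj (join G (completeG 1)) hub hub
  hub-loopless rewrite splitAt-↑ʳ m 1 zero = λ ()

module Cycle {n : ℕ} (2<n : 2 < n) where

  0<n : 0 < n
  0<n = ℕ.<-trans (s≤s z≤n) 2<n

  open CyclicSuccessor n {{>-nonZero 0<n}}
  open ZeroForcing (cycleG n)

  1<n : 1 < n
  1<n = ℕ.<-trans (s≤s (s≤s z≤n)) 2<n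

  edge-forces : ∀ a → AlwaysForces (pair a (next a))
  edge-forces a S edge⊆S (z , z∉S)
    with first-exit {_∈ S} (_∈? S) (edge⊆S ∈pair₁) (edge⊆S ∈pair₂) z∉S
  ... | y , prev-y∈S , y∈S , next-y∉S =
    _ , force y (next y) y∈S next-y∉S (adj-next y) others
    where
    others : ∀ t → Adj (cycleG n) y t → t ≢ next y → t ∈ S
    others t y~t t≢next with neighbours {y} {t} y~t
    ... | inj₁ t≡next = contradiction t≡next t≢next
    ... | inj₂ refl   = prev-y∈S

  edge-core : ∀ {S} → ∃ (λ a → a ∈ S × next a ∈ S) → ContainsZFSOfSize 2 S
  edge-core (a , a∈S , next-a∈S) = pair a (next a) , pair⊆ a∈S next-a∈S
    , alwaysForces⇒zeroForcing (edge-forces a) , ∣pair∣ (next≢ 1<n a ∘ sym)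

  core : ∀ S → IsZeroForcingSet (cycleG n) S → ContainsZFSOfSize 2 S
  core S zfs with initial-step zfs
  ... | inj₁ refl = edge-core (fromℕ< 0<n , ∈⊤ , ∈⊤)
  ... | inj₂ (_ , force u w u∈S _ u~w others) =
    edge-core (adjacent-pair-beside 2<n {_∈ S} {u} {w} u~w u∈S others)

  cycle-ZbarEqZ : ZbarEqZ (cycleG n)
  cycle-ZbarEqZ = containsZFSOfSize⇒ZbarEqZ 2 core

module Wheel {m : ℕ} (2<m : 2 < m) where

  0<m : 0 < m
  0<m = ℕ.<-trans (s≤s z≤n) 2<m

  open CyclicSuccessor m {{>-nonZero 0<m}}
  open JoinWithVertex (cycleG m)
  open ZeroForcing (wheelG m)

  1<m : 1 < m
  1<m = ℕ.<-trans (s≤s (s≤s z≤n)) 2<m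

  spoke-forces : ∀ a → AlwaysForces (triple hub (rim a) (rim (next a)))
  spoke-forces a S spoke⊆S (z , z∉S) with view z
  ... | at-hub = contradiction (spoke⊆S ∈triple₁) z∉S
  ... | at-rim _ with first-exit {λ r → rim r ∈ S} (λ r → rim r ∈? S)
                                 (spoke⊆S ∈triple₂) (spoke⊆S ∈triple₃) z∉S
  ... | y , prev-y∈S , y∈S , next-y∉S =
    _ , force (rim y) (rim (next y)) y∈S next-y∉S (rim-adj {y} {next y} (adj-next y)) others
    where
    others : ∀ t → Adj (wheelG m) (rim y) t → t ≢ rim (next y) → t ∈ S
    others t y~t t≢next with view t
    ... | at-hub = spoke⊆S ∈triple₁
    ... | at-rim s with neighbours {y} {s} (rim-adj⁻ {y} {s} y~t)
    ...   | inj₁ refl = contradiction refl t≢next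
    ...   | inj₂ refl = prev-y∈S

  path-forces : ∀ u → AlwaysForces (triple (rim (prev u)) (rim u) (rim (next u)))
  path-forces u S path⊆S white with hub ∈? S
  ... | yes hub∈S = spoke-forces u S (triple⊆ hub∈S (path⊆S ∈triple₂) (path⊆S ∈triple₃)) white
  ... | no  hub∉S = _ , force (rim u) hub (path⊆S ∈triple₂) hub∉S (rim-hub u) others
    where
    others : ∀ t → Adj (wheelG m) (rim u) t → t ≢ hub → t ∈ S
    others t u~t t≢hub with view t
    ... | at-hub = contradiction refl t≢hub
    ... | at-rim s with neighbours {u} {s} (rim-adj⁻ {u} {s} u~t)
    ...   | inj₁ refl = path⊆S ∈triple₃
    ...   | inj₂ refl = path⊆S ∈triple₁

  spoke-core : ∀ {S} → hub ∈ S → ∃ (λ a → rim a ∈ S × rim (next a) ∈ S) →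
               ContainsZFSOfSize 3 S
  spoke-core hub∈S (a , a∈S , next-a∈S) =
    triple hub (rim a) (rim (next a)) , triple⊆ hub∈S a∈S next-a∈S
    , alwaysForces⇒zeroForcing (spoke-forces a)
    , ∣triple∣ (rim≢hub a ∘ sym) (rim≢hub (next a) ∘ sym) (next≢ 1<m a ∘ sym ∘ rim-injective)

  path-core : ∀ {S} u → rim (prev u) ∈ S → rim u ∈ S → rim (next u) ∈ S →
              ContainsZFSOfSize 3 S
  path-core u prev-u∈S u∈S next-u∈S =
    triple (rim (prev u)) (rim u) (rim (next u)) , triple⊆ prev-u∈S u∈S next-u∈S
    , alwaysForces⇒zeroForcing (path-forces u)
    , ∣triple∣ (prev≢ 1<m u ∘ rim-injective) (prev≢next 2<m u ∘ rim-injective)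
               (next≢ 1<m u ∘ sym ∘ rim-injective)

  core : ∀ S → IsZeroForcingSet (wheelG m) S → ContainsZFSOfSize 3 S
  core S zfs with initial-step zfs
  ... | inj₁ refl = spoke-core ∈⊤ (fromℕ< 0<m , ∈⊤ , ∈⊤)
  ... | inj₂ (_ , force u w u∈S _ u~w others) with view u | view w
  ...   | at-hub   | at-hub   = contradiction u~w hub-loopless
  ...   | at-rim r | at-hub   =
    path-core r (others _ (rim-adj {r} {prev r} (adj-prev r)) (rim≢hub _)) u∈S
                (others _ (rim-adj {r} {next r} (adj-next r)) (rim≢hub _))
  ...   | at-hub   | at-rim s =
    spoke-core u∈S (next s , others _ (hub-rim _) (next≢ 1<m s ∘ rim-injective)
                           , others _ (hub-rim _) (next²≢ 2<m s ∘ rim-injective))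
  ...   | at-rim r | at-rim s =
    spoke-core (others hub (rim-hub r) (rim≢hub s ∘ sym))
      (adjacent-pair-beside 2<m {λ x → rim x ∈ S} {r} {s} (rim-adj⁻ {r} {s} u~w) u∈S
        (λ t r~t t≢s → others (rim t) (rim-adj {r} {t} r~t) (t≢s ∘ rim-injective)))

  wheel-ZbarEqZ : ZbarEqZ (wheelG m)
  wheel-ZbarEqZ = containsZFSOfSize⇒ZbarEqZ 3 core

module ManyLeavedStar (k : ℕ) where

  m : ℕ
  m = suc (suc k)

  open JoinWithVertex (emptyG m)
  open ZeroForcing (starG m)

  no-rim-edge : ∀ r s → ¬ Adj (starG m) (rim r) (rim s)
  no-rim-edge r s r~s with () ← rim-adj⁻ {r} {s} r~s

  leaves-twins : ∀ r s → Twins (rim r) (rim s)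
  leaves-twins r s = only-hub-adjacent {r} {s} , only-hub-adjacent {s} {r}
    where
    only-hub-adjacent : ∀ {r s} t → Adj (starG m) t (rim r) → Adj (starG m) t (rim s)
    only-hub-adjacent {r} {s} t t~r with view t
    ... | at-hub    = hub-rim s
    ... | at-rim t′ = contradiction t~r (no-rim-edge t′ r)

  AllLeavesBut : Fin m → Subset (m + 1)
  AllLeavesBut l = ∁ (pair (rim l) hub)

  ∈allLeavesBut : ∀ {l s} → s ≢ l → rim s ∈ AllLeavesBut l
  ∈allLeavesBut {l} {s} s≢l = x∉p⇒x∈∁p (Data.Sum.[ s≢l ∘ rim-injective , rim≢hub s ] ∘ ∈pair⁻)

  ∈allLeavesBut⁻ : ∀ {l s} → rim s ∈ AllLeavesBut l → s ≢ l
  ∈allLeavesBut⁻ {l} s∈ refl = x∈∁p⇒x∉p s∈ (∈pair₁ {a = rim l} {b = hub})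

  hub∉allLeavesBut : ∀ {l} → hub ∉ AllLeavesBut l
  hub∉allLeavesBut {l} hub∈ = x∈∁p⇒x∉p hub∈ (∈pair₂ {a = rim l} {b = hub})

  leaf-forces-hub : ∀ {S} l → AllLeavesBut l ⊆ S → hub ∉ S → ∃ (ForceStep (starG m) S)
  leaf-forces-hub l leaves⊆S hub∉S =
    _ , force (rim l′) hub (leaves⊆S (∈allLeavesBut l′≢l)) hub∉S (rim-hub l′) others
    where
    l′ = punchIn l zero
    l′≢l = punchInᵢ≢i l zero
    others : ∀ t → Adj (starG m) (rim l′) t → t ≢ hub → t ∈ _
    others t l′~t t≢hub with view t
    ... | at-hub   = contradiction refl t≢hub
    ... | at-rim s = contradiction l′~t (no-rim-edge l′ s)

  allLeavesBut-forces : ∀ l → AlwaysForces (AllLeavesBut l)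
  allLeavesBut-forces l S leaves⊆S (z , z∉S) with view z
  ... | at-hub = leaf-forces-hub l leaves⊆S z∉S
  ... | at-rim s with s ≟ l
  ...   | no  s≢l  = contradiction (leaves⊆S (∈allLeavesBut s≢l)) z∉S
  ...   | yes refl with hub ∈? S
  ...     | no  hub∉S = leaf-forces-hub s leaves⊆S hub∉S
  ...     | yes hub∈S = _ , force hub (rim s) hub∈S z∉S (hub-rim s) others
    where
    others : ∀ t → Adj (starG m) hub t → t ≢ rim s → t ∈ S
    others t hub~t t≢s with view t
    ... | at-hub   = contradiction hub~t hub-loopless
    ... | at-rim r = leaves⊆S (∈allLeavesBut (t≢s ∘ cong rim))

  core-at : ∀ {S} l → (∀ s → s ≢ l → rim s ∈ S) → ContainsZFSOfSize (m + 1 ∸ 2) S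
  core-at {S} l leaves =
    AllLeavesBut l , ⊆S , alwaysForces⇒zeroForcing (allLeavesBut-forces l)
    , trans (∣∁p∣≡n∸∣p∣ (pair (rim l) hub)) (cong (m + 1 ∸_) (∣pair∣ (rim≢hub l)))
    where
    ⊆S : AllLeavesBut l ⊆ S
    ⊆S {x} x∈ with view x
    ... | at-hub   = contradiction x∈ hub∉allLeavesBut
    ... | at-rim s = leaves s (∈allLeavesBut⁻ x∈)

  core : ∀ S → IsZeroForcingSet (starG m) S → ContainsZFSOfSize (m + 1 ∸ 2) S
  core S zfs with all? (λ l → rim l ∈? S)
  ... | yes all-leaves = core-at zero (λ s _ → all-leaves s)
  ... | no  ¬all-leaves with l , rim-l∉S ← ¬∀⟶∃¬ m _ (λ l → rim l ∈? S) ¬all-leaves =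
    core-at l λ s s≢l → Data.Sum.[ id , (λ rim-l∈S → contradiction rim-l∈S rim-l∉S) ]
      (zeroForcing-meets-twins (leaves-twins s l) (s≢l ∘ rim-injective) zfs)

  star-ZbarEqZ : ZbarEqZ (starG m)
  star-ZbarEqZ = containsZFSOfSize⇒ZbarEqZ (m + 1 ∸ 2) core

star-ZbarEqZ : ∀ m → ZbarEqZ (starG m)
star-ZbarEqZ zero            = ZeroForcing.edgeless⇒ZbarEqZ (starG 0) λ { zero zero () }
star-ZbarEqZ (suc (suc k))   = ManyLeavedStar.star-ZbarEqZ k
star-ZbarEqZ (suc zero)      = complete⇒ZbarEqZ (starG 1) adjacent
  where
  adjacent : Complete (starG 1)
  adjacent {zero}     {zero}     0≢0 = contradiction refl 0≢0
  adjacent {zero}     {suc zero} _   = refl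
  adjacent {suc zero} {zero}     _   = refl
  adjacent {suc zero} {suc zero} 1≢1 = contradiction refl 1≢1

empty-ZbarEqZ : ∀ n → ZbarEqZ (emptyG n)
empty-ZbarEqZ n = ZeroForcing.edgeless⇒ZbarEqZ (emptyG n) (λ _ _ ())

complete-ZbarEqZ : ∀ n → ZbarEqZ (completeG n)
complete-ZbarEqZ zero          = ZeroForcing.edgeless⇒ZbarEqZ (completeG 0) (λ ())
complete-ZbarEqZ (suc zero)    = ZeroForcing.edgeless⇒ZbarEqZ (completeG 1) λ { zero zero () }
complete-ZbarEqZ (suc (suc k)) = complete⇒ZbarEqZ (completeG (suc (suc k))) adjacent
  where
  adjacent : Complete (completeG (suc (suc k)))
  adjacent {u} {w} u≢w with u ≟ w
  ... | yes u≡w = contradiction u≡w u≢w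
  ... | no  _   = refl

corollary3p3 : ((n : ℕ) → 3 ≤ n → ZbarEqZ (cycleG n))
    × ((n : ℕ) → ZbarEqZ (emptyG n))
    × ((m : ℕ) → ZbarEqZ (starG m))
    × ((m : ℕ) → 3 ≤ m → ZbarEqZ (wheelG m))
    × ((n : ℕ) → ZbarEqZ (completeG n))
corollary3p3 =
  (λ _ 3≤n → Cycle.cycle-ZbarEqZ 3≤n) , empty-ZbarEqZ , star-ZbarEqZ ,
  (λ _ 3≤m → Wheel.wheel-ZbarEqZ 3≤m) , complete-ZbarEqZ
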